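{- Let $Q\in\{1,2,6,42,1806\}$ and $\mathfrak{N}_Q=\{n\in\mathbb{N}: S_{Qn}(Qn)\equiv n\pmod{Qn}\}$. Then $$\mathbb{N}\setminus\mathfrak{N}_Q=\bigcup_{d\mid Q}W_d(Q),\qquad W_d(Q)=\left\{K\frac{p(p-1)}{d}: p\text{ prime},\ p\nmid Q,\ d\mid p-1,\ K\in\mathbb{N}\right\}.$$
   Context: $\mathbb{N}=\{1,2,3,\dots\}$. For positive integers $m,k$, $S_m(k):=1^m+2^m+\cdots+k^m$. The union is over positive divisors $d$ of $Q$. -}

module Defs where

open import Data.Nat using (ℕ; zero; suc; _+_; _^_)
open import Data.Integer as ℤ using (ℤ; +_; _-_)
open import Data.Integer.Divisibility as ℤD using ()

S : ℕ → ℕ → ℕ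
S m zero    = 0
S m (suc k) = S m k + suc k ^ m

_≡_[mod_] : ℕ → ℕ → ℕ → Set
a ≡ b [mod m ] = (+ m) ℤD.∣ ((+ a) - (+ b))

open import Data.Nat using (_*_)
InN : ℕ → ℕ → Set
InN Q n = S (Q * n) (Q * n) ≡ n [mod Q * n ]

-- Write m = Q n.  For a prime p, S_m(p) ≡ -1 (mod p) when (p - 1) ∣ m (Fermat) and S_m(p) ≡ 0
-- otherwise (expand i^m in the basis of binomial coefficients C i j and sum over i < p).
-- Expanding (t N + i)^m to first order in t N lifts this to prime powers: if m = r p^(b+1)
-- (and m is even when p = 2), then S_m(m) ≡ r p^b S_m(p) (mod p^(b+1)).  So modulo each
-- prime power dividing m, S_m(m) is either 0 or -r p^b.  For p ∣ Q the identities
-- (p - 1) ∣ Q and p ∣ Q/p + 1, satisfied by Q ∈ {1, 2, 6, 42, 1806}, make -r p^b ≡ n; for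
-- p ∤ Q the value is 0 ≡ n unless p ∣ n and (p - 1) ∣ m.  Such a bad prime really breaks the
-- congruence, since then n ≡ 0 while p ∤ r makes r p^b ≢ 0, and the bad primes are exactly
-- those in the sets W_d(Q), with d = gcd(p - 1, Q).

module Submission where

open import Defs
open import Data.Nat using (ℕ; _*_; _∸_; _/_; _≤_; NonZero)
open import Data.Nat.Divisibility using (_∣_; _∤_)
open import Data.Nat.Primality using (Prime)
open import Data.List using (List; _∷_; [])
open import Data.List.Membership.Propositional using (_∈_)
open import Data.Product using (Σ; _×_)
open import Relation.Nullary using (¬_)
open import Relation.Binary.PropositionalEquality using (_≡_)
open import Function.Bundles using (_⇔_)

open import Data.Nat
open import Data.Nat.Properties
open import Data.Nat.Divisibility
open import Data.Nat.Primality
open import Data.Nat.Primality.Factorisation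
  using (PrimeFactorisation; factorise; factorisationHasAllPrimeFactors)
open import Data.Nat.DivMod using (_%_; m≡m%n+[m/n]*n; m%n<n; m/n*n≡m; *-/-assoc; m*n/n≡m)
open import Data.Nat.GCD using (gcd; gcd[m,n]∣m; gcd[m,n]∣n; gcd[m,n]≢0)
open import Data.Nat.Coprimality using (coprime-/gcd; coprime-divisor)
open import Data.Nat.Induction using (<-rec)
open import Data.Nat.ListAction using (product)
open import Data.Nat.Tactic.RingSolver using (solve-∀)
import Data.Integer as ℤ
import Data.Integer.Properties as ℤ
import Data.Integer.Divisibility.Signed as ℤ∣
open import Data.Integer.Divisibility.Signed using (∣ᵤ⇒∣; ∣⇒∣ᵤ)
import Data.Integer.Tactic.RingSolver as ℤ-Solver
open import Data.Fin using (Fin; toℕ; fromℕ<)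
open import Data.Fin.Properties using (any?; toℕ-fromℕ<)
open import Data.Vec using (Vec; []; _∷_)
open import Data.List.Relation.Unary.All as All using (All; []; _∷_)
open import Data.List.Relation.Unary.Any using (here; there)
open import Data.Product using (∃; ∃₂; _,_; proj₂)
open import Data.Sum using (_⊎_; inj₁; inj₂; [_,_]′)
open import Function.Base using (id)
open import Function.Bundles using (mk⇔)
open import Relation.Binary.PropositionalEquality
open import Relation.Nullary
open import Relation.Nullary.Decidable using (from-yes; _×-dec_; ¬?)

private
  variable
    a b c d m p r : ℕ

prime>1 : Prime p → 1 < p
prime>1 pr = nonTrivial⇒n>1 _ {{prime⇒nonTrivial pr}}

-- Binomial coefficients and Fermat's little theorem

C : ℕ → ℕ → ℕ
C n       zero    = 1
C zero    (suc k) = 0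
C (suc n) (suc k) = C n k + C n (suc k)

C-vanishes : ∀ n k → n < k → C n k ≡ 0
C-vanishes zero    (suc k) _         = refl
C-vanishes (suc n) (suc k) (s≤s n<k) =
  cong₂ _+_ (C-vanishes n k n<k) (C-vanishes n (suc k) (m<n⇒m<1+n n<k))

C[n,1]≡n : ∀ n → C n 1 ≡ n
C[n,1]≡n zero    = refl
C[n,1]≡n (suc n) = cong suc (C[n,1]≡n n)

C[n,n]≡1 : ∀ n → C n n ≡ 1
C[n,n]≡1 zero    = refl
C[n,n]≡1 (suc n) = cong₂ _+_ (C[n,n]≡1 n) (C-vanishes n (suc n) (n<1+n n))

C-absorption : ∀ n k → suc k * C (suc n) (suc k) ≡ suc n * C n k
C-absorption zero    zero    = refl
C-absorption zero    (suc k) = *-zeroʳ (suc (suc k))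
C-absorption (suc n) zero    =
  cong (λ c → suc (suc c)) (trans (+-identityʳ (C n 1)) (trans (C[n,1]≡n n) (sym (*-identityʳ n))))
C-absorption (suc n) (suc k) = begin
  suc (suc k) * (C (suc n) (suc k) + C (suc n) (suc (suc k)))
    ≡⟨ distribute (C (suc n) (suc k)) (C (suc n) (suc (suc k))) k ⟩
  C (suc n) (suc k) + suc k * C (suc n) (suc k) + suc (suc k) * C (suc n) (suc (suc k))
    ≡⟨ cong₂ (λ a b → C (suc n) (suc k) + a + b) (C-absorption n k) (C-absorption n (suc k)) ⟩
  C (suc n) (suc k) + suc n * C n k + suc n * C n (suc k)
    ≡⟨ collect (C n k) (C n (suc k)) n ⟩
  suc (suc n) * C (suc n) (suc k) ∎
  where
  open ≡-Reasoning
  distribute : ∀ a b k → suc (suc k) * (a + b) ≡ a + suc k * a + suc (suc k) * b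
  distribute = solve-∀
  collect : ∀ a b n → (a + b) + suc n * a + suc n * b ≡ suc (suc n) * (a + b)
  collect = solve-∀

x*C[x,j] : ∀ x j → x * C x j ≡ j * C x j + suc j * C x (suc j)
x*C[x,j] zero    zero    = refl
x*C[x,j] zero    (suc j) = sym (cong₂ _+_ (*-zeroʳ (suc j)) (*-zeroʳ (suc (suc j))))
x*C[x,j] (suc x) zero    =
  cong suc (trans (*-identityʳ x) (sym (trans (+-identityʳ (C x 1)) (C[n,1]≡n x))))
x*C[x,j] (suc x) (suc j) = begin
  suc x * (C x j + C x (suc j))
    ≡⟨ distribute x (C x j) (C x (suc j)) ⟩
  C x j + C x (suc j) + x * C x j + x * C x (suc j)
    ≡⟨ cong₂ (λ u v → C x j + C x (suc j) + u + v) (x*C[x,j] x j) (x*C[x,j] x (suc j)) ⟩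
  C x j + C x (suc j) + (j * C x j + suc j * C x (suc j))
    + (suc j * C x (suc j) + suc (suc j) * C x (suc (suc j)))
    ≡⟨ collect j (C x j) (C x (suc j)) (C x (suc (suc j))) ⟩
  suc j * (C x j + C x (suc j)) + suc (suc j) * (C x (suc j) + C x (suc (suc j))) ∎
  where
  open ≡-Reasoning
  distribute : ∀ x a b → suc x * (a + b) ≡ a + b + x * a + x * b
  distribute = solve-∀
  collect : ∀ j a b c → a + b + (j * a + suc j * b) + (suc j * b + suc (suc j) * c)
                      ≡ suc j * (a + b) + suc (suc j) * (b + c)
  collect = solve-∀

prime∣C : Prime p → ∀ {s} → 0 < s → s < p → p ∣ C p s
prime∣C {suc p′} pr {suc s′} _ s<p
  with euclidsLemma (suc s′) (C (suc p′) (suc s′)) pr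
         (divides (C p′ s′) (trans (C-absorption p′ s′) (*-comm (suc p′) _)))
... | inj₁ p∣s = contradiction (∣⇒≤ p∣s) (<⇒≱ s<p)
... | inj₂ p∣C = p∣C

binomialSum : ℕ → ℕ → ℕ → ℕ
binomialSum n a zero    = 0
binomialSum n a (suc M) = binomialSum n a M + C n M * a ^ M

binomialSum-pascal : ∀ n a M →
  binomialSum (suc n) a (suc M) ≡ binomialSum n a (suc M) + a * binomialSum n a M
binomialSum-pascal n a zero    = cong (1 +_) (sym (*-zeroʳ a))
binomialSum-pascal n a (suc M) =
  trans (cong (λ s → s + (C n M + C n (suc M)) * (a * a ^ M)) (binomialSum-pascal n a M))
        (regroup (binomialSum n a M) (C n M) (C n (suc M)) a (a ^ M))
  where
  regroup : ∀ f c d a x → f + c * x + a * f + (c + d) * (a * x)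
                        ≡ f + c * x + d * (a * x) + a * (f + c * x)
  regroup = solve-∀

binomial-theorem : ∀ a n → suc a ^ n ≡ binomialSum n a (suc n)
binomial-theorem a zero    = refl
binomial-theorem a (suc n) = begin
  suc a * suc a ^ n
    ≡⟨ cong (suc a *_) (binomial-theorem a n) ⟩
  suc a * binomialSum n a (suc n)
    ≡⟨ cong (_+ a * binomialSum n a (suc n)) (sym top-term-vanishes) ⟩
  binomialSum n a (suc (suc n)) + a * binomialSum n a (suc n)
    ≡⟨ sym (binomialSum-pascal n a (suc n)) ⟩
  binomialSum (suc n) a (suc (suc n)) ∎
  where
  open ≡-Reasoning
  top-term-vanishes : binomialSum n a (suc (suc n)) ≡ binomialSum n a (suc n)
  top-term-vanishes =
    trans (cong (λ c → binomialSum n a (suc n) + c * a ^ suc n) (C-vanishes n (suc n) (n<1+n n)))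
          (+-identityʳ _)

binomialSum-prime≡1 : Prime p → ∀ a M → 1 ≤ M → M ≤ p → ∃ λ X → binomialSum p a M ≡ 1 + p * X
binomialSum-prime≡1 {p} pr a (suc zero)    _ _    = 0 , cong suc (sym (*-zeroʳ p))
binomialSum-prime≡1 {p} pr a (suc (suc M)) _ M<p
  with binomialSum-prime≡1 pr a (suc M) (s≤s z≤n) (<⇒≤ M<p) | prime∣C pr (s≤s z≤n) M<p
... | X , sum≡ | divides q C≡ =
  X + q * a ^ suc M ,
  trans (cong₂ (λ s c → s + c * a ^ suc M) sum≡ C≡) (regroup X q p (a ^ suc M))
  where
  regroup : ∀ X q p y → 1 + p * X + q * p * y ≡ 1 + p * (X + q * y)
  regroup = solve-∀

fermat : Prime p → ∀ a → ∃ λ X → a ^ p ≡ a + p * X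
fermat {suc p′} pr zero = 0 , sym (*-zeroʳ (suc p′))
fermat {p} pr (suc a)
  with fermat pr a | binomialSum-prime≡1 pr a p (<⇒≤ (prime>1 pr)) ≤-refl
... | X , a^p≡ | Y , sum≡ = Y + X , (begin
  suc a ^ p                              ≡⟨ binomial-theorem a p ⟩
  binomialSum p a p + C p p * a ^ p      ≡⟨ cong₂ (λ s c → s + c * a ^ p) sum≡ (C[n,n]≡1 p) ⟩
  1 + p * Y + 1 * a ^ p                  ≡⟨ cong (λ x → 1 + p * Y + 1 * x) a^p≡ ⟩
  1 + p * Y + 1 * (a + p * X)            ≡⟨ regroup p a X Y ⟩
  suc a + p * (Y + X)                    ∎)
  where
  open ≡-Reasoning
  regroup : ∀ p a X Y → 1 + p * Y + 1 * (a + p * X) ≡ suc a + p * (Y + X)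
  regroup = solve-∀

fermat-unit : Prime p → ∀ i → p ∤ i → ∃ λ X → i ^ (p ∸ 1) ≡ 1 + p * X
fermat-unit {p}      pr zero     p∤0 = contradiction (p ∣0) p∤0
fermat-unit {suc p′} pr i@(suc _) p∤i =
  [ (λ p∣i → contradiction p∣i p∤i) , quotient-witness ]′
    (euclidsLemma i (i ^ p′ ∸ 1) pr p∣i*[i^p′∸1])
  where
  open ≡-Reasoning
  p∣i*[i^p′∸1] : suc p′ ∣ i * (i ^ p′ ∸ 1)
  p∣i*[i^p′∸1] = let X , i^p≡ = fermat pr i in divides X (+-cancelˡ-≡ i _ _ (begin
    i + i * (i ^ p′ ∸ 1)    ≡⟨ cong (_+ i * (i ^ p′ ∸ 1)) (sym (*-identityʳ i)) ⟩
    i * 1 + i * (i ^ p′ ∸ 1) ≡⟨ sym (*-distribˡ-+ i 1 (i ^ p′ ∸ 1)) ⟩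
    i * (1 + (i ^ p′ ∸ 1))  ≡⟨ cong (i *_) (m+[n∸m]≡n (m^n>0 i p′)) ⟩
    i ^ suc p′              ≡⟨ i^p≡ ⟩
    i + suc p′ * X          ≡⟨ cong (i +_) (*-comm (suc p′) X) ⟩
    i + X * suc p′          ∎))
  quotient-witness : suc p′ ∣ i ^ p′ ∸ 1 → ∃ λ X → i ^ p′ ≡ 1 + suc p′ * X
  quotient-witness (divides q i^p′∸1≡) =
    q , trans (sym (m+[n∸m]≡n (m^n>0 i p′)))
              (cong (1 +_) (trans i^p′∸1≡ (*-comm q (suc p′))))

[1+p*X]^q : ∀ p X q → ∃ λ Y → (1 + p * X) ^ q ≡ 1 + p * Y
[1+p*X]^q p X zero    = 0 , cong suc (sym (*-zeroʳ p))
[1+p*X]^q p X (suc q) =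
  let Y , eq = [1+p*X]^q p X q in
  X + Y + p * X * Y , trans (cong ((1 + p * X) *_) eq) (expand p X Y)
  where
  expand : ∀ p X Y → (1 + p * X) * (1 + p * Y) ≡ 1 + p * (X + Y + p * X * Y)
  expand = solve-∀

pow-reduce : Prime p → ∀ i → p ∤ i → ∀ r q → ∃ λ Y → i ^ (r + q * (p ∸ 1)) ≡ i ^ r + p * Y
pow-reduce {p} pr i p∤i r q =
  let X , i^[p-1]≡ = fermat-unit pr i p∤i
      Y , [1+pX]^q≡ = [1+p*X]^q p X q
  in i ^ r * Y , (begin
    i ^ (r + q * (p ∸ 1))      ≡⟨ ^-distribˡ-+-* i r _ ⟩
    i ^ r * i ^ (q * (p ∸ 1))  ≡⟨ cong (λ e → i ^ r * i ^ e) (*-comm q (p ∸ 1)) ⟩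
    i ^ r * i ^ ((p ∸ 1) * q)  ≡⟨ cong (i ^ r *_) (sym (^-*-assoc i (p ∸ 1) q)) ⟩
    i ^ r * (i ^ (p ∸ 1)) ^ q  ≡⟨ cong (λ u → i ^ r * u ^ q) i^[p-1]≡ ⟩
    i ^ r * (1 + p * X) ^ q    ≡⟨ cong (i ^ r *_) [1+pX]^q≡ ⟩
    i ^ r * (1 + p * Y)        ≡⟨ distribute (i ^ r) p Y ⟩
    i ^ r + p * (i ^ r * Y)    ∎)
  where
  open ≡-Reasoning
  distribute : ∀ a p Y → a * (1 + p * Y) ≡ a + p * (a * Y)
  distribute = solve-∀

-- Power sums modulo a prime

evalC : ∀ {n} → ℕ → Vec ℕ n → ℕ → ℕ
evalC j []       x = 0
evalC j (c ∷ cs) x = c * C x j + evalC (suc j) cs x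

addToHead : ∀ {n} → ℕ → Vec ℕ (suc n) → Vec ℕ (suc n)
addToHead c (b ∷ bs) = c + b ∷ bs

evalC-addToHead : ∀ {n} j c (bs : Vec ℕ (suc n)) x →
                  evalC j (addToHead c bs) x ≡ c * C x j + evalC j bs x
evalC-addToHead j c (b ∷ bs) x = distribute c b (C x j) (evalC (suc j) bs x)
  where
  distribute : ∀ c b y z → (c + b) * y + z ≡ c * y + (b * y + z)
  distribute = solve-∀

mulX : ∀ {n} → ℕ → Vec ℕ n → Vec ℕ (suc n)
mulX j []       = 0 ∷ []
mulX j (c ∷ cs) = j * c ∷ addToHead (suc j * c) (mulX (suc j) cs)

evalC-mulX : ∀ {n} j (cs : Vec ℕ n) x → evalC j (mulX j cs) x ≡ x * evalC j cs x
evalC-mulX j []       x = sym (*-zeroʳ x)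
evalC-mulX j (c ∷ cs) x = begin
  j * c * C x j + evalC (suc j) (addToHead (suc j * c) (mulX (suc j) cs)) x
    ≡⟨ cong (j * c * C x j +_) (evalC-addToHead (suc j) (suc j * c) (mulX (suc j) cs) x) ⟩
  j * c * C x j + (suc j * c * C x (suc j) + evalC (suc j) (mulX (suc j) cs) x)
    ≡⟨ cong (λ e → j * c * C x j + (suc j * c * C x (suc j) + e)) (evalC-mulX (suc j) cs x) ⟩
  j * c * C x j + (suc j * c * C x (suc j) + x * evalC (suc j) cs x)
    ≡⟨ factor j c (C x j) (C x (suc j)) (x * evalC (suc j) cs x) ⟩
  c * (j * C x j + suc j * C x (suc j)) + x * evalC (suc j) cs x
    ≡⟨ cong (λ u → c * u + x * evalC (suc j) cs x) (sym (x*C[x,j] x j)) ⟩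
  c * (x * C x j) + x * evalC (suc j) cs x
    ≡⟨ pull-out c x (C x j) (evalC (suc j) cs x) ⟩
  x * (c * C x j + evalC (suc j) cs x) ∎
  where
  open ≡-Reasoning
  factor : ∀ j c a b z → j * c * a + (suc j * c * b + z) ≡ c * (j * a + suc j * b) + z
  factor = solve-∀
  pull-out : ∀ c x a e → c * (x * a) + x * e ≡ x * (c * a + e)
  pull-out = solve-∀

-- x ^ k in the basis C x j: the coefficients are j! times Stirling numbers of the second kind
powerCoeffs : ∀ k → Vec ℕ (suc k)
powerCoeffs zero    = 1 ∷ []
powerCoeffs (suc k) = mulX 0 (powerCoeffs k)

evalC-powerCoeffs : ∀ k x → evalC 0 (powerCoeffs k) x ≡ x ^ k
evalC-powerCoeffs zero    x = refl
evalC-powerCoeffs (suc k) x =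
  trans (evalC-mulX 0 (powerCoeffs k) x) (cong (x *_) (evalC-powerCoeffs k x))

evalC-pascal : ∀ {n} j (cs : Vec ℕ n) N →
               evalC (suc j) cs (suc N) ≡ evalC (suc j) cs N + evalC j cs N
evalC-pascal j []       N = refl
evalC-pascal j (c ∷ cs) N =
  trans (cong (c * (C N j + C N (suc j)) +_) (evalC-pascal (suc j) cs N))
        (regroup c (C N j) (C N (suc j)) (evalC (suc (suc j)) cs N) (evalC (suc j) cs N))
  where
  regroup : ∀ c a b s e → c * (a + b) + (s + e) ≡ c * b + s + (c * a + e)
  regroup = solve-∀

evalC-at-0 : ∀ {n} j (cs : Vec ℕ n) → evalC (suc j) cs 0 ≡ 0
evalC-at-0 j []       = refl
evalC-at-0 j (c ∷ cs) = cong₂ _+_ (*-zeroʳ c) (evalC-at-0 (suc j) cs)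

prime∣evalC : Prime p → ∀ {n} j (cs : Vec ℕ n) → j + n < p → p ∣ evalC (suc j) cs p
prime∣evalC pr j []       _  = _ ∣0
prime∣evalC {p} pr {suc n} j (c ∷ cs) lt =
  ∣m∣n⇒∣m+n (∣n⇒∣m*n c (prime∣C pr z<s (≤-<-trans (m≤m+n (suc j) n) lt′)))
            (prime∣evalC pr (suc j) cs lt′)
  where
  lt′ : suc j + n < p
  lt′ = subst (_< p) (+-suc j n) lt

powerSumBelow : ℕ → ℕ → ℕ
powerSumBelow k zero    = 0
powerSumBelow k (suc N) = powerSumBelow k N + N ^ k

powerSumBelow≡evalC : ∀ k N → powerSumBelow k N ≡ evalC 1 (powerCoeffs k) N
powerSumBelow≡evalC k zero    = sym (evalC-at-0 0 (powerCoeffs k))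
powerSumBelow≡evalC k (suc N) = begin
  powerSumBelow k N + N ^ k
    ≡⟨ cong₂ _+_ (powerSumBelow≡evalC k N) (sym (evalC-powerCoeffs k N)) ⟩
  evalC 1 (powerCoeffs k) N + evalC 0 (powerCoeffs k) N
    ≡⟨ sym (evalC-pascal 0 (powerCoeffs k) N) ⟩
  evalC 1 (powerCoeffs k) (suc N) ∎
  where open ≡-Reasoning

-- Summing over x < p turns each C x j into C p (j + 1) (Pascal), a multiple of p for j + 1 < p.
prime∣powerSumBelow : Prime p → ∀ k → suc k < p → p ∣ powerSumBelow k p
prime∣powerSumBelow {p} pr k lt =
  subst (p ∣_) (sym (powerSumBelow≡evalC k p)) (prime∣evalC pr 0 (powerCoeffs k) lt)

powerSumBelow≡S : ∀ k N → powerSumBelow (suc k) (suc N) ≡ S (suc k) N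
powerSumBelow≡S k zero    = refl
powerSumBelow≡S k (suc N) = cong (_+ suc N ^ suc k) (powerSumBelow≡S k N)

S-cong : ∀ m k r N → (∀ i → 1 ≤ i → i ≤ N → ∃ λ Y → i ^ k ≡ i ^ r + m * Y) →
         ∃ λ Y → S k N ≡ S r N + m * Y
S-cong m k r zero    _  = 0 , sym (*-zeroʳ m)
S-cong m k r (suc N) i^k≡ =
  let Y  , S≡   = S-cong m k r N (λ i 1≤i i≤N → i^k≡ i 1≤i (m≤n⇒m≤1+n i≤N))
      Y′ , N^k≡ = i^k≡ (suc N) (s≤s z≤n) ≤-refl
  in Y + Y′ , trans (cong₂ _+_ S≡ N^k≡) (regroup (S r N) (suc N ^ r) m Y Y′)
  where
  regroup : ∀ a b m Y Y′ → a + m * Y + (b + m * Y′) ≡ a + b + m * (Y + Y′)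
  regroup = solve-∀

S[p∸1]-reduce-exponent : Prime p → ∀ r q →
  ∃ λ Y → S (r + q * (p ∸ 1)) (p ∸ 1) ≡ S r (p ∸ 1) + p * Y
S[p∸1]-reduce-exponent {suc p′} pr r q = S-cong (suc p′) (r + q * p′) r p′
  (λ i 1≤i i≤p′ → pow-reduce pr i (>⇒∤ {{>-nonZero 1≤i}} (s≤s i≤p′)) r q)

prime∣S+1 : Prime p → ∀ k → 1 ≤ k → (p ∸ 1) ∣ k → p ∣ S k p + 1
prime∣S+1 {p@(suc p′)} pr (suc k′) _ (divides q k≡) =
  let Y , S≡ = S[p∸1]-reduce-exponent pr 0 q in
  divides (suc (Y + p ^ k′)) (begin
    S k p′ + p ^ k + 1           ≡⟨ cong (λ e → S e p′ + p ^ k + 1) k≡ ⟩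
    S (q * p′) p′ + p ^ k + 1    ≡⟨ cong (λ s → s + p ^ k + 1) S≡ ⟩
    S 0 p′ + p * Y + p ^ k + 1   ≡⟨ cong (λ s → s + p * Y + p ^ k + 1) (S[0,N]≡N p′) ⟩
    p′ + p * Y + p * p ^ k′ + 1  ≡⟨ collect p′ Y (p ^ k′) ⟩
    suc (Y + p ^ k′) * p         ∎)
  where
  open ≡-Reasoning
  k = suc k′
  S[0,N]≡N : ∀ N → S 0 N ≡ N
  S[0,N]≡N zero    = refl
  S[0,N]≡N (suc N) = trans (cong (_+ 1) (S[0,N]≡N N)) (+-comm N 1)
  collect : ∀ p′ Y z → p′ + suc p′ * Y + suc p′ * z + 1 ≡ suc (Y + z) * suc p′
  collect = solve-∀

prime∣S-reduced : Prime p → ∀ r q → suc (suc r) < p → p ∣ S (suc r + q * (p ∸ 1)) p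
prime∣S-reduced {suc p′} pr r q lt =
  let Y , S≡ = S[p∸1]-reduce-exponent pr (suc r) q in
  ∣m∣n⇒∣m+n (subst (suc p′ ∣_) (sym S≡) (∣m∣n⇒∣m+n p∣S[r] (∣m⇒∣m*n Y ∣-refl)))
            (∣m⇒∣m*n (suc p′ ^ (r + q * p′)) ∣-refl)
  where
  p∣S[r] : suc p′ ∣ S (suc r) p′
  p∣S[r] = subst (suc p′ ∣_) (powerSumBelow≡S r p′) (prime∣powerSumBelow pr (suc r) lt)

prime∣S : Prime p → ∀ k → (p ∸ 1) ∤ k → p ∣ S k p
prime∣S {p@(suc (suc p″))} pr k p-1∤k with k % suc p″ in k%≡ | m≡m%n+[m/n]*n k (suc p″)
... | zero   | k≡ = contradiction (divides (k / suc p″) k≡) p-1∤k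
... | suc r  | k≡ = subst (λ e → p ∣ S e p) (sym k≡)
        (prime∣S-reduced pr r (k / suc p″) (s≤s (subst (_< suc p″) k%≡ (m%n<n k (suc p″)))))

-- Power sums over multiples

binomial-first-order : ∀ t i j →
  ∃ λ X → (t + i) ^ suc j ≡ i ^ suc j + suc j * t * i ^ j + t * t * X
binomial-first-order t i zero    = 0 , base t i
  where
  base : ∀ t i → (t + i) * 1 ≡ i * 1 + 1 * t * 1 + t * t * 0
  base = solve-∀
binomial-first-order t i (suc j) =
  let X , eq = binomial-first-order t i j in
  suc j * i ^ j + t * X + X * i , trans (cong ((t + i) *_) eq) (expand t i (i ^ j) X j)
  where
  expand : ∀ t i y X j → (t + i) * (i * y + suc j * t * y + t * t * X)
                       ≡ i * (i * y) + suc (suc j) * t * (i * y) + t * t * (suc j * y + t * X + X * i)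
  expand = solve-∀

shiftedS : ℕ → ℕ → ℕ → ℕ
shiftedS k t zero    = 0
shiftedS k t (suc N) = shiftedS k t N + (t + suc N) ^ k

S-split : ∀ k t N → S k (t + N) ≡ S k t + shiftedS k t N
S-split k t zero    = trans (cong (S k) (+-identityʳ t)) (sym (+-identityʳ (S k t)))
S-split k t (suc N) = begin
  S k (t + suc N)                                ≡⟨ cong (S k) (+-suc t N) ⟩
  S k (t + N) + suc (t + N) ^ k                  ≡⟨ cong (_+ suc (t + N) ^ k) (S-split k t N) ⟩
  S k t + shiftedS k t N + suc (t + N) ^ k       ≡⟨ +-assoc (S k t) _ _ ⟩
  S k t + (shiftedS k t N + suc (t + N) ^ k)
    ≡⟨ cong (λ x → S k t + (shiftedS k t N + x ^ k)) (sym (+-suc t N)) ⟩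
  S k t + shiftedS k t (suc N)                   ∎
  where open ≡-Reasoning

shiftedS-expand : ∀ j t N →
  ∃ λ Y → shiftedS (suc j) t N ≡ S (suc j) N + suc j * t * S j N + t * t * Y
shiftedS-expand j t zero    = 0 , base j t
  where
  base : ∀ j t → 0 ≡ 0 + suc j * t * 0 + t * t * 0
  base = solve-∀
shiftedS-expand j t (suc N) =
  let Y , sum≡ = shiftedS-expand j t N
      X , term≡ = binomial-first-order t (suc N) j
  in Y + X , trans (cong₂ _+_ sum≡ term≡)
                   (regroup (S (suc j) N) (S j N) (suc N ^ suc j) (suc N ^ j) j t Y X)
  where
  regroup : ∀ a b c d j t Y X → a + suc j * t * b + t * t * Y + (c + suc j * t * d + t * t * X)
                              ≡ a + c + suc j * t * (b + d) + t * t * (Y + X)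
  regroup = solve-∀

triangle : ℕ → ℕ
triangle zero    = 0
triangle (suc c) = triangle c + c

2*triangle : ∀ c → 2 * triangle (suc c) ≡ suc c * c
2*triangle zero    = refl
2*triangle (suc c) = begin
  2 * (triangle (suc c) + suc c)    ≡⟨ *-distribˡ-+ 2 (triangle (suc c)) (suc c) ⟩
  2 * triangle (suc c) + 2 * suc c  ≡⟨ cong (_+ 2 * suc c) (2*triangle c) ⟩
  suc c * c + 2 * suc c             ≡⟨ square c ⟩
  suc (suc c) * suc c               ∎
  where
  open ≡-Reasoning
  square : ∀ c → suc c * c + 2 * suc c ≡ suc (suc c) * suc c
  square = solve-∀

S-multiple : ∀ j N c → ∃ λ Z →
  S (suc j) (c * N) ≡ c * S (suc j) N + suc j * N * S j N * triangle c + N * N * Z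
S-multiple j N zero    = 0 , base j N (S j N)
  where
  base : ∀ j N s → 0 ≡ 0 + suc j * N * s * 0 + N * N * 0
  base = solve-∀
S-multiple j N (suc c) =
  let Z , S≡ = S-multiple j N c
      Y , shifted≡ = shiftedS-expand j (c * N) N
  in Z + c * c * Y , (begin
    S (suc j) (N + c * N)                     ≡⟨ cong (S (suc j)) (+-comm N (c * N)) ⟩
    S (suc j) (c * N + N)                     ≡⟨ S-split (suc j) (c * N) N ⟩
    S (suc j) (c * N) + shiftedS (suc j) (c * N) N ≡⟨ cong₂ _+_ S≡ shifted≡ ⟩
    c * A + suc j * N * B * triangle c + N * N * Z + (A + suc j * (c * N) * B + c * N * (c * N) * Y)
      ≡⟨ regroup c A j N B (triangle c) Z Y ⟩
    suc c * A + suc j * N * B * triangle (suc c) + N * N * (Z + c * c * Y) ∎)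
  where
  open ≡-Reasoning
  A = S (suc j) N
  B = S j N
  regroup : ∀ c A j N B t Z Y →
    c * A + suc j * N * B * t + N * N * Z + (A + suc j * (c * N) * B + c * N * (c * N) * Y)
    ≡ suc c * A + suc j * N * B * (t + c) + N * N * (Z + c * c * Y)
  regroup = solve-∀

-- triangle p = p (p - 1) / 2 is a multiple of p unless p = 2.
prime∣s*triangle : Prime p → ∀ s → p ≢ 2 ⊎ 2 ∣ s → p ∣ s * triangle p
prime∣s*triangle {p@(suc p′)} pr s (inj₂ (divides h s≡)) = divides (h * p′) (begin
  s * triangle p         ≡⟨ cong (_* triangle p) s≡ ⟩
  h * 2 * triangle p     ≡⟨ *-assoc h 2 (triangle p) ⟩
  h * (2 * triangle p)   ≡⟨ cong (h *_) (2*triangle p′) ⟩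
  h * (p * p′)           ≡⟨ rearrange h p p′ ⟩
  h * p′ * p             ∎)
  where
  open ≡-Reasoning
  rearrange : ∀ h p q → h * (p * q) ≡ h * q * p
  rearrange = solve-∀
prime∣s*triangle {p@(suc p′)} pr s (inj₁ p≢2) =
  [ (λ p∣2 → contradiction (p∣2⇒p≡2 p∣2) p≢2) , ∣n⇒∣m*n s ]′
    (euclidsLemma 2 (triangle p) pr (divides p′ (trans (2*triangle p′) (*-comm p p′))))
  where
  p∣2⇒p≡2 : p ∣ 2 → p ≡ 2
  p∣2⇒p≡2 p∣2 = [ (λ p≡1 → contradiction (subst Prime p≡1 pr) ¬prime[1]) , id ]′
                   (prime⇒irreducible prime[2] p∣2)

S-prime-multiple : ∀ j N → Prime p → p ∣ N → p ≢ 2 ⊎ 2 ∣ suc j →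
                   ∃ λ W → S (suc j) (p * N) ≡ p * S (suc j) N + p * N * W
S-prime-multiple {p} j N pr (divides N′ N≡) p≢2⊎2∣k =
  let Z , S≡ = S-multiple j N p
      divides E E≡ = prime∣s*triangle pr (suc j) p≢2⊎2∣k
  in S j N * E + N′ * Z , (begin
    S (suc j) (p * N)                                 ≡⟨ S≡ ⟩
    p * A + suc j * N * B * triangle p + N * N * Z
      ≡⟨ cong (λ u → p * A + u + N * N * Z) (rearrange (suc j) N B (triangle p)) ⟩
    p * A + N * B * (suc j * triangle p) + N * N * Z
      ≡⟨ cong₂ (λ u v → p * A + N * B * u + N * v * Z) E≡ N≡ ⟩
    p * A + N * B * (E * p) + N * (N′ * p) * Z        ≡⟨ collect p A N B E N′ Z ⟩
    p * A + p * N * (B * E + N′ * Z)                  ∎)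
  where
  open ≡-Reasoning
  A = S (suc j) N
  B = S j N
  rearrange : ∀ s N B t → s * N * B * t ≡ N * B * (s * t)
  rearrange = solve-∀
  collect : ∀ p A N B E N′ Z → p * A + N * B * (E * p) + N * (N′ * p) * Z
                             ≡ p * A + p * N * (B * E + N′ * Z)
  collect = solve-∀

S-prime-power : ∀ j b → Prime p → p ≢ 2 ⊎ 2 ∣ suc j →
                ∃ λ W → S (suc j) (p ^ suc b) ≡ p ^ b * S (suc j) p + p ^ suc b * W
S-prime-power {p} j zero pr p≢2⊎2∣m =
  0 , trans (cong (S (suc j)) (*-identityʳ p))
            (sym (trans (cong₂ _+_ (*-identityˡ (S (suc j) p)) (*-zeroʳ (p * 1))) (+-identityʳ _)))
S-prime-power {p} j (suc b) pr p≢2⊎2∣m =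
  let W  , S≡  = S-prime-power j b pr p≢2⊎2∣m
      W′ , S≡′ = S-prime-multiple j (p ^ suc b) pr (m∣m*n (p ^ b)) p≢2⊎2∣m
  in W + W′ , (begin
    S (suc j) (p * p ^ suc b)                            ≡⟨ S≡′ ⟩
    p * S (suc j) (p ^ suc b) + p * p ^ suc b * W′       ≡⟨ cong (λ u → p * u + p * p ^ suc b * W′) S≡ ⟩
    p * (p ^ b * Sₚ + p * p ^ b * W) + p * (p * p ^ b) * W′ ≡⟨ regroup p (p ^ b) Sₚ W W′ ⟩
    p * p ^ b * Sₚ + p * (p * p ^ b) * (W + W′)          ∎)
  where
  open ≡-Reasoning
  Sₚ = S (suc j) p
  regroup : ∀ p x s W W′ → p * (x * s + p * x * W) + p * (p * x) * W′
                         ≡ p * x * s + p * (p * x) * (W + W′)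
  regroup = solve-∀

S-multiple-mod : ∀ j N r → ∃ λ V → S (suc j) (r * N) ≡ r * S (suc j) N + N * V
S-multiple-mod j N r =
  let Z , S≡ = S-multiple j N r in
  suc j * S j N * triangle r + N * Z , trans S≡ (regroup r (S (suc j) N) j N (S j N) (triangle r) Z)
  where
  regroup : ∀ r A j N B t Z → r * A + suc j * N * B * t + N * N * Z
                            ≡ r * A + N * (suc j * B * t + N * Z)
  regroup = solve-∀

S-multiple-of-prime-power : ∀ j r b → Prime p → p ≢ 2 ⊎ 2 ∣ suc j →
  ∃ λ Z → S (suc j) (r * p ^ suc b) ≡ r * p ^ b * S (suc j) p + p ^ suc b * Z
S-multiple-of-prime-power {p} j r b pr p≢2⊎2∣m =
  let V , S≡  = S-multiple-mod j (p ^ suc b) r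
      W , S≡′ = S-prime-power j b pr p≢2⊎2∣m
  in r * W + V , trans S≡ (trans (cong (λ s → r * s + p ^ suc b * V) S≡′)
                                 (regroup r (p ^ b) (S (suc j) p) p W V))
  where
  regroup : ∀ r x s p W V → r * (x * s + p * x * W) + p * x * V ≡ r * x * s + p * x * (r * W + V)
  regroup = solve-∀

S[m,m]-mod-prime-power : Prime p → 1 ≤ m → ∀ r b → m ≡ r * p ^ suc b →
                         ∃ λ Z → S m m ≡ r * p ^ b * S m p + p ^ suc b * Z
S[m,m]-mod-prime-power {p} {suc j} pr _ r b m≡ =
  let Z , S≡ = S-multiple-of-prime-power j r b pr p≢2⊎2∣m in
  Z , trans (cong (S (suc j)) m≡) S≡
  where
  p≢2⊎2∣m : p ≢ 2 ⊎ 2 ∣ suc j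
  p≢2⊎2∣m with p ≟ 2
  ... | yes refl = inj₂ (divides (r * p ^ b) (trans m≡ (rearrange r p (p ^ b))))
    where
    rearrange : ∀ r p x → r * (p * x) ≡ r * x * p
    rearrange = solve-∀
  ... | no p≢2 = inj₁ p≢2

p^[1+b]∣S[m,m]+r*p^b : Prime p → 1 ≤ m → ∀ r b → m ≡ r * p ^ suc b → (p ∸ 1) ∣ m →
                       p ^ suc b ∣ S m m + r * p ^ b
p^[1+b]∣S[m,m]+r*p^b {p} {m} pr 1≤m r b m≡ p-1∣m =
  let Z , S≡ = S[m,m]-mod-prime-power pr 1≤m r b m≡
      divides A A≡ = prime∣S+1 pr m 1≤m p-1∣m
  in divides (r * A + Z) (begin
    S m m + r * x                               ≡⟨ cong (_+ r * x) S≡ ⟩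
    r * x * S m p + p * x * Z + r * x           ≡⟨ regroup r x (S m p) p Z ⟩
    r * x * (S m p + 1) + p * x * Z             ≡⟨ cong (λ s → r * x * s + p * x * Z) A≡ ⟩
    r * x * (A * p) + p * x * Z                 ≡⟨ collect r x A p Z ⟩
    (r * A + Z) * (p * x)                       ∎)
  where
  open ≡-Reasoning
  x = p ^ b
  regroup : ∀ r x s p Z → r * x * s + p * x * Z + r * x ≡ r * x * (s + 1) + p * x * Z
  regroup = solve-∀
  collect : ∀ r x A p Z → r * x * (A * p) + p * x * Z ≡ (r * A + Z) * (p * x)
  collect = solve-∀

p^[1+b]∣S[m,m] : Prime p → 1 ≤ m → ∀ r b → m ≡ r * p ^ suc b → (p ∸ 1) ∤ m → p ^ suc b ∣ S m m
p^[1+b]∣S[m,m] {p} {m} pr 1≤m r b m≡ p-1∤m =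
  let Z , S≡ = S[m,m]-mod-prime-power pr 1≤m r b m≡
      divides A A≡ = prime∣S pr m p-1∤m
  in divides (r * A + Z) (begin
    S m m                            ≡⟨ S≡ ⟩
    r * x * S m p + p * x * Z        ≡⟨ cong (λ s → r * x * s + p * x * Z) A≡ ⟩
    r * x * (A * p) + p * x * Z      ≡⟨ collect r x A p Z ⟩
    (r * A + Z) * (p * x)            ∎)
  where
  open ≡-Reasoning
  x = p ^ b
  collect : ∀ r x A p Z → r * x * (A * p) + p * x * Z ≡ (r * A + Z) * (p * x)
  collect = solve-∀

-- Congruences and local-to-global divisibility

≡[mod]-intro : m ∣ a + c → m ∣ b + c → a ≡ b [mod m ]
≡[mod]-intro {m} {a} {c} {b} m∣a+c m∣b+c =
  ∣⇒∣ᵤ (subst (ℤ.+ m ℤ∣.∣_) difference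
    (ℤ∣.∣m∣n⇒∣m-n (∣ᵤ⇒∣ {ℤ.+ m} {ℤ.+ (a + c)} m∣a+c)
                  (∣ᵤ⇒∣ {ℤ.+ m} {ℤ.+ (b + c)} m∣b+c)))
  where
  cancel : ∀ x y z → (x ℤ.+ z) ℤ.- (y ℤ.+ z) ≡ x ℤ.- y
  cancel = ℤ-Solver.solve-∀
  difference : ℤ.+ (a + c) ℤ.- ℤ.+ (b + c) ≡ ℤ.+ a ℤ.- ℤ.+ b
  difference = trans (cong₂ ℤ._-_ (ℤ.pos-+ a c) (ℤ.pos-+ b c)) (cancel (ℤ.+ a) (ℤ.+ b) (ℤ.+ c))

∣∧∣⇒≡[mod] : m ∣ a → m ∣ b → a ≡ b [mod m ]
∣∧∣⇒≡[mod] {m} {a} {b} m∣a m∣b =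
  ≡[mod]-intro {a = a} {c = 0} {b = b} (subst (m ∣_) (sym (+-identityʳ a)) m∣a)
                                       (subst (m ∣_) (sym (+-identityʳ b)) m∣b)

≡[mod]∧∣⇒∣ : a ≡ b [mod m ] → m ∣ b → m ∣ a
≡[mod]∧∣⇒∣ {a} {b} {m} a≡b m∣b =
  ∣⇒∣ᵤ {ℤ.+ m} {ℤ.+ a} (subst (ℤ.+ m ℤ∣.∣_) (cancel (ℤ.+ a) (ℤ.+ b))
    (ℤ∣.∣m∣n⇒∣m+n (∣ᵤ⇒∣ {ℤ.+ m} {ℤ.+ a ℤ.- ℤ.+ b} a≡b) (∣ᵤ⇒∣ {ℤ.+ m} {ℤ.+ b} m∣b)))
  where
  cancel : ∀ x y → (x ℤ.- y) ℤ.+ y ≡ x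
  cancel = ℤ-Solver.solve-∀

-- Congruence mod m is divisibility of a natural number (an absolute value) by m.
≡[mod]-weaken : d ∣ m → a ≡ b [mod m ] → a ≡ b [mod d ]
≡[mod]-weaken = ∣-trans

prime^-divisor : Prime p → p ∤ m → ∀ e {n} → p ^ e ∣ m * n → p ^ e ∣ n
prime^-divisor pr p∤m zero {n} _ = 1∣ n
prime^-divisor {p} {m} pr p∤m (suc e) p^[1+e]∣mn
  with euclidsLemma m _ pr (∣-trans (m∣m*n (p ^ e)) p^[1+e]∣mn)
... | inj₁ p∣m               = contradiction p∣m p∤m
... | inj₂ (divides n′ refl) =
  subst (p ^ suc e ∣_) (*-comm p n′)
    (*-monoʳ-∣ p (prime^-divisor pr p∤m e
      (*-cancelˡ-∣ p {{prime⇒nonZero pr}} (subst (p ^ suc e ∣_) (rearrange m n′ p) p^[1+e]∣mn))))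
  where
  rearrange : ∀ m n p → m * (n * p) ≡ p * (m * n)
  rearrange = solve-∀

prime^*coprime-∣ : Prime p → p ∤ r → ∀ e {y} → p ^ e ∣ y → r ∣ y → p ^ e * r ∣ y
prime^*coprime-∣ {p} {r} pr p∤r e p^e∣y (divides y′ refl) =
  *-monoˡ-∣ r (prime^-divisor pr p∤r e (subst (p ^ e ∣_) (*-comm y′ r) p^e∣y))

factor-out : Prime p → ∀ n → 0 < n → ∃₂ λ e r → n ≡ p ^ e * r × p ∤ r
factor-out {p} pr = <-rec _ step
  where
  step : ∀ n → (∀ {n′} → n′ < n → 0 < n′ → ∃₂ λ e r → n′ ≡ p ^ e * r × p ∤ r) →
         0 < n → ∃₂ λ e r → n ≡ p ^ e * r × p ∤ r
  step n rec 0<n with p ∣? n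
  ... | no p∤n = 0 , n , sym (+-identityʳ n) , p∤n
  ... | yes (divides zero    n≡) = contradiction n≡ (>⇒≢ 0<n)
  ... | yes (divides q@(suc _) n≡) =
    let e , r , q≡ , p∤r = rec (subst (q <_) (sym n≡) (m<m*n q p (prime>1 pr))) z<s
    in suc e , r , trans n≡ (trans (cong (_* p) q≡) (rearrange (p ^ e) r p)) , p∤r
    where
    rearrange : ∀ x r p → x * r * p ≡ p * x * r
    rearrange = solve-∀

prime-divisor : ∀ n → 1 < n → ∃ λ p → Prime p × p ∣ n
prime-divisor n 1<n = from-factorisation (factorise n {{>-nonZero (<-trans z<s 1<n)}})
  where
  from-factorisation : PrimeFactorisation n → ∃ λ p → Prime p × p ∣ n
  from-factorisation record { factors = [] ; isFactorisation = n≡1 } = contradiction n≡1 (>⇒≢ 1<n)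
  from-factorisation record { factors = p ∷ ps ; isFactorisation = n≡ ; factorsPrime = pr ∷ _ } =
    p , pr , divides (product ps) (trans n≡ (*-comm p (product ps)))

PrimePowersDivide : ℕ → ℕ → Set
PrimePowersDivide m y = ∀ {p} b → Prime p → p ^ suc b ∣ m → p ^ suc b ∣ y

prime-powers-∣⇒∣ : ∀ m {y} → 0 < m → PrimePowersDivide m y → m ∣ y
prime-powers-∣⇒∣ m {y} = <-rec _ step m
  where
  step : ∀ m → (∀ {r} → r < m → 0 < r → PrimePowersDivide r y → r ∣ y) →
         0 < m → PrimePowersDivide m y → m ∣ y
  step (suc zero) _ _ _ = 1∣ y
  step m@(suc (suc _)) rec 0<m local with prime-divisor m (s≤s z<s)
  ... | p , pr , p∣m with factor-out pr m 0<m
  ...   | zero  , r , m≡ , p∤r = contradiction (subst (p ∣_) (trans m≡ (+-identityʳ r)) p∣m) p∤r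
  ...   | suc b , r , m≡ , p∤r = subst (_∣ y) (sym m≡)
    (prime^*coprime-∣ pr p∤r (suc b) (local b pr (divides r (trans m≡ (*-comm (p ^ suc b) r))))
      (rec r<m 0<r (λ b′ pr′ d → local b′ pr′ (∣-trans d r∣m))))
    where
    r∣m : r ∣ m
    r∣m = divides (p ^ suc b) m≡
    0<r : 0 < r
    0<r = n≢0⇒n>0 λ r≡0 → >⇒≢ 0<m (trans m≡ (trans (cong (p ^ suc b *_) r≡0) (*-zeroʳ (p ^ suc b))))
    1<p^[1+b] : 1 < p ^ suc b
    1<p^[1+b] = *-mono-≤ (prime>1 pr) (m^n>0 p {{prime⇒nonZero pr}} b)
    r<m : r < m
    r<m = subst (r <_) (trans (*-comm r (p ^ suc b)) (sym m≡))
                (m<m*n r (p ^ suc b) {{>-nonZero 0<r}} 1<p^[1+b])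

-- Bad primes

BadPrime : ℕ → ℕ → ℕ → Set
BadPrime Q n p = Prime p × p ∣ n × p ∤ Q × (p ∸ 1) ∣ Q * n

badPrime? : ∀ Q n → 0 < n → Dec (∃ (BadPrime Q n))
badPrime? Q n 0<n with any? (λ (i : Fin (suc n)) → badPrime-at? (toℕ i))
  where
  badPrime-at? : ∀ p → Dec (BadPrime Q n p)
  badPrime-at? p = prime? p ×-dec p ∣? n ×-dec ¬? (p ∣? Q) ×-dec (p ∸ 1) ∣? Q * n
... | yes (i , bad) = yes (toℕ i , bad)
... | no none = no λ (p , bad) →
  none (fromℕ< (p<1+n bad) , subst (BadPrime Q n) (sym (toℕ-fromℕ< (p<1+n bad))) bad)
  where
  p<1+n : ∀ {p} → BadPrime Q n p → p < suc n
  p<1+n (_ , p∣n , _) = s≤s (∣⇒≤ {{>-nonZero 0<n}} p∣n)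

-- p ∣ Q / p + 1 for all primes p ∣ Q defines the primary pseudoperfect numbers
PrimeFactorCondition : ℕ → ℕ → Set
PrimeFactorCondition Q p = ∃ λ Q′ → Q ≡ p * Q′ × p ∣ suc Q′ × (p ∸ 1) ∣ Q

record Admissible (Q : ℕ) : Set where
  field
    positive             : 0 < Q
    primeFactorCondition : ∀ {p} → Prime p → p ∣ Q → PrimeFactorCondition Q p

product-admissible : ∀ {ps} → All Prime ps → All (PrimeFactorCondition (product ps)) ps →
                     Admissible (product ps)
product-admissible prs conditions = record
  { positive             = productOfPrimes≥1 prs
  ; primeFactorCondition = λ pr p∣Q → All.lookup conditions (factorisationHasAllPrimeFactors pr p∣Q prs)
  }

prime[3] : Prime 3
prime[3] = from-yes (prime? 3)

prime[7] : Prime 7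
prime[7] = from-yes (prime? 7)

prime[43] : Prime 43
prime[43] = from-yes (prime? 43)

listed-admissible : ∀ {Q} → Q ∈ (1 ∷ 2 ∷ 6 ∷ 42 ∷ 1806 ∷ []) → Admissible Q
listed-admissible (here refl) = product-admissible {[]} [] []
listed-admissible (there (here refl)) = product-admissible (prime[2] ∷ [])
  ((1 , refl , divides 1 refl , divides 2 refl) ∷ [])
listed-admissible (there (there (here refl))) = product-admissible (prime[2] ∷ prime[3] ∷ [])
  ( (3 , refl , divides 2 refl , divides 6 refl)
  ∷ (2 , refl , divides 1 refl , divides 3 refl) ∷ [])
listed-admissible (there (there (there (here refl)))) =
  product-admissible (prime[2] ∷ prime[3] ∷ prime[7] ∷ [])
  ( (21 , refl , divides 11 refl , divides 42 refl)
  ∷ (14 , refl , divides 5 refl , divides 21 refl)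
  ∷ (6 , refl , divides 1 refl , divides 7 refl) ∷ [])
listed-admissible (there (there (there (there (here refl))))) =
  product-admissible (prime[2] ∷ prime[3] ∷ prime[7] ∷ prime[43] ∷ [])
  ( (903 , refl , divides 452 refl , divides 1806 refl)
  ∷ (602 , refl , divides 201 refl , divides 903 refl)
  ∷ (258 , refl , divides 37 refl , divides 301 refl)
  ∷ (42 , refl , divides 1 refl , divides 43 refl) ∷ [])

badPrime⇒¬InN : ∀ {Q n p} → 0 < Q → 0 < n → BadPrime Q n p → ¬ InN Q n
badPrime⇒¬InN {Q} {n} {p} 0<Q 0<n (pr , p∣n , p∤Q , p-1∣Qn) inN with factor-out pr n 0<n
... | zero  , r , n≡ , p∤r = contradiction (subst (p ∣_) (trans n≡ (+-identityʳ r)) p∣n) p∤r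
... | suc b , r , n≡ , p∤r = [ p∤Q , p∤r ]′ (euclidsLemma Q r pr p∣Qr)
  where
  Qn≡ : Q * n ≡ Q * r * p ^ suc b
  Qn≡ = trans (cong (Q *_) n≡) (rearrange Q (p ^ suc b) r)
    where
    rearrange : ∀ Q x r → Q * (x * r) ≡ Q * r * x
    rearrange = solve-∀
  p^[1+b]∣S+Qr*p^b : p ^ suc b ∣ S (Q * n) (Q * n) + Q * r * p ^ b
  p^[1+b]∣S+Qr*p^b = p^[1+b]∣S[m,m]+r*p^b pr (*-mono-≤ 0<Q 0<n) (Q * r) b Qn≡ p-1∣Qn
  p^[1+b]∣S : p ^ suc b ∣ S (Q * n) (Q * n)
  p^[1+b]∣S = ≡[mod]∧∣⇒∣ {b = n} (≡[mod]-weaken {b = n} (divides (Q * r) Qn≡) inN)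
                         (divides r (trans n≡ (*-comm (p ^ suc b) r)))
  p∣Qr : p ∣ Q * r
  p∣Qr = *-cancelʳ-∣ (p ^ b) {{m^n≢0 p b {{prime⇒nonZero pr}}}}
           (∣m+n∣m⇒∣n p^[1+b]∣S+Qr*p^b p^[1+b]∣S)

S≡n-at-prime-of-Q : ∀ {Q n} → Prime p → 0 < Q * n → PrimeFactorCondition Q p →
                    ∀ r b → Q * n ≡ r * p ^ suc b → S (Q * n) (Q * n) ≡ n [mod p ^ suc b ]
S≡n-at-prime-of-Q {p} {Q} {n} pr 0<Qn (Q′ , Q≡ , p∣1+Q′ , p-1∣Q) r b Qn≡ =
  ≡[mod]-intro {c = r * p ^ b} (p^[1+b]∣S[m,m]+r*p^b pr 0<Qn r b Qn≡ (∣-trans p-1∣Q (m∣m*n n)))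
               (prime^-divisor pr p∤Q′ (suc b) p^[1+b]∣Q′*[n+r*p^b])
  where
  x = p ^ b
  p∤Q′ : p ∤ Q′
  p∤Q′ p∣Q′ = nonTrivial⇒≢1 {{prime⇒nonTrivial pr}}
    (∣1⇒≡1 (∣m+n∣m⇒∣n (subst (p ∣_) (+-comm 1 Q′) p∣1+Q′) p∣Q′))
  Q′n≡rx : Q′ * n ≡ r * x
  Q′n≡rx = *-cancelˡ-≡ _ _ p {{prime⇒nonZero pr}} (begin
    p * (Q′ * n)  ≡⟨ sym (*-assoc p Q′ n) ⟩
    p * Q′ * n    ≡⟨ cong (_* n) (sym Q≡) ⟩
    Q * n         ≡⟨ Qn≡ ⟩
    r * (p * x)   ≡⟨ rearrange r p x ⟩
    p * (r * x)   ∎)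
    where
    open ≡-Reasoning
    rearrange : ∀ r p x → r * (p * x) ≡ p * (r * x)
    rearrange = solve-∀
  p^[1+b]∣Q′*[n+r*p^b] : p ^ suc b ∣ Q′ * (n + r * x)
  p^[1+b]∣Q′*[n+r*p^b] = subst (p ^ suc b ∣_) (sym Q′*[n+rx]≡) (∣m⇒∣m*n r (*-monoˡ-∣ x p∣1+Q′))
    where
    open ≡-Reasoning
    Q′*[n+rx]≡ : Q′ * (n + r * x) ≡ suc Q′ * x * r
    Q′*[n+rx]≡ = begin
      Q′ * (n + r * x)         ≡⟨ *-distribˡ-+ Q′ n (r * x) ⟩
      Q′ * n + Q′ * (r * x)    ≡⟨ cong (_+ Q′ * (r * x)) Q′n≡rx ⟩
      r * x + Q′ * (r * x)     ≡⟨ rearrange r x Q′ ⟩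
      suc Q′ * x * r           ∎
      where
      rearrange : ∀ r x Q′ → r * x + Q′ * (r * x) ≡ suc Q′ * x * r
      rearrange = solve-∀

S≡n-away-from-Q : ∀ {Q n} → Prime p → 0 < Q * n → p ∤ Q → ¬ BadPrime Q n p →
                  ∀ r b → Q * n ≡ r * p ^ suc b → S (Q * n) (Q * n) ≡ n [mod p ^ suc b ]
S≡n-away-from-Q {p} {Q} {n} pr 0<Qn p∤Q notBad r b Qn≡ =
  ∣∧∣⇒≡[mod] (p^[1+b]∣S[m,m] pr 0<Qn r b Qn≡ (λ p-1∣Qn → notBad (pr , p∣n , p∤Q , p-1∣Qn)))
             (prime^-divisor pr p∤Q (suc b) (divides r Qn≡))
  where
  p∣n : p ∣ n
  p∣n = [ (λ p∣Q → contradiction p∣Q p∤Q) , id ]′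
          (euclidsLemma Q n pr (divides (r * p ^ b) (trans Qn≡ (rearrange r p (p ^ b)))))
    where
    rearrange : ∀ r p x → r * (p * x) ≡ r * x * p
    rearrange = solve-∀

noBadPrime⇒InN : ∀ {Q n} → Admissible Q → 0 < n → (∀ p → ¬ BadPrime Q n p) → InN Q n
noBadPrime⇒InN {Q} {n} admissible 0<n noBad = prime-powers-∣⇒∣ (Q * n) 0<Qn local
  where
  open Admissible admissible
  0<Qn : 0 < Q * n
  0<Qn = *-mono-≤ positive 0<n
  local : ∀ {p} b → Prime p → p ^ suc b ∣ Q * n → S (Q * n) (Q * n) ≡ n [mod p ^ suc b ]
  local {p} b pr (divides r Qn≡) with p ∣? Q
  ... | yes p∣Q = S≡n-at-prime-of-Q pr 0<Qn (primeFactorCondition pr p∣Q) r b Qn≡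
  ... | no  p∤Q = S≡n-away-from-Q pr 0<Qn p∤Q (noBad p) r b Qn≡

InW : ℕ → ℕ → Set
InW Q n = Σ ℕ (λ d → Σ (NonZero d) (λ nz → d ∣ Q ×
            Σ ℕ (λ p → Σ ℕ (λ K → Prime p × p ∤ Q × d ∣ (p ∸ 1) × 1 ≤ K ×
              n ≡ K * _/_ (p * (p ∸ 1)) d {{nz}}))))

badPrime⇒InW : ∀ {Q n p} → 0 < n → BadPrime Q n p → InW Q n
badPrime⇒InW {Q} {n} {p} 0<n (pr , p∣n , p∤Q , p-1∣Qn) =
  g , g≢0 , gcd[m,n]∣n (p ∸ 1) Q , p , K , pr , p∤Q , gcd[m,n]∣m (p ∸ 1) Q , 0<K , n≡K*[p[p-1]/g]
  where
  p-1≢0 : p ∸ 1 ≢ 0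
  p-1≢0 = m>n⇒m∸n≢0 (prime>1 pr)
  g = gcd (p ∸ 1) Q
  g≢0 : NonZero g
  g≢0 = ≢-nonZero (gcd[m,n]≢0 (p ∸ 1) Q (inj₁ p-1≢0))
  instance _ = g≢0
  e = (p ∸ 1) / g
  e*g≡p-1 : e * g ≡ p ∸ 1
  e*g≡p-1 = m/n*n≡m (gcd[m,n]∣m (p ∸ 1) Q)
  e∣n : e ∣ n
  e∣n = coprime-divisor (coprime-/gcd (p ∸ 1) Q)
          (*-cancelʳ-∣ g (subst₂ _∣_ (sym e*g≡p-1) Q*n≡ p-1∣Qn))
    where
    rearrange : ∀ q g n → q * g * n ≡ q * n * g
    rearrange = solve-∀
    Q*n≡ : Q * n ≡ Q / g * n * g
    Q*n≡ = trans (cong (_* n) (sym (m/n*n≡m (gcd[m,n]∣n (p ∸ 1) Q)))) (rearrange (Q / g) g n)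
  p∤e : p ∤ e
  p∤e p∣e = >⇒∤ {{≢-nonZero p-1≢0}} (∸-monoʳ-< z<s (<⇒≤ (prime>1 pr)))
                 (∣-trans p∣e (divides g (trans (sym e*g≡p-1) (*-comm e g))))
  n₁ = quotient e∣n
  p∣n₁ : p ∣ n₁
  p∣n₁ = [ id , (λ p∣e → contradiction p∣e p∤e) ]′
           (euclidsLemma n₁ e pr (subst (p ∣_) (m∣n⇒n≡quotient*m e∣n) p∣n))
  K = quotient p∣n₁
  n≡K*[p*e] : n ≡ K * (p * e)
  n≡K*[p*e] = trans (m∣n⇒n≡quotient*m e∣n)
                    (trans (cong (_* e) (m∣n⇒n≡quotient*m p∣n₁)) (*-assoc K p e))
  n≡K*[p[p-1]/g] : n ≡ K * (p * (p ∸ 1) / g)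
  n≡K*[p[p-1]/g] = trans n≡K*[p*e] (cong (K *_) (sym (*-/-assoc p (gcd[m,n]∣m (p ∸ 1) Q))))
  0<K : 1 ≤ K
  0<K = n≢0⇒n>0 λ K≡0 → >⇒≢ 0<n (trans n≡K*[p*e] (cong (_* (p * e)) K≡0))

InW⇒badPrime : ∀ {Q n} → InW Q n → ∃ (BadPrime Q n)
InW⇒badPrime {Q} {n} (d , d≢0 , divides q Q≡ , p , K , pr , p∤Q , divides e p-1≡ , _ , n≡) =
  p , pr , divides (K * e) (trans n≡K*[p*e] (rearrange K p e)) , p∤Q , p-1∣Qn
  where
  instance _ = d≢0
  n≡K*[p*e] : n ≡ K * (p * e)
  n≡K*[p*e] = trans n≡ (cong (K *_) (trans (*-/-assoc p (divides e p-1≡))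
                                           (cong (p *_) (trans (cong (_/ d) p-1≡) (m*n/n≡m e d)))))
  rearrange : ∀ K p e → K * (p * e) ≡ K * e * p
  rearrange = solve-∀
  p-1∣Qn : (p ∸ 1) ∣ Q * n
  p-1∣Qn = divides (q * K * p) (trans (cong₂ _*_ Q≡ n≡K*[p*e])
             (trans (regroup q d K p e) (cong (q * K * p *_) (sym p-1≡))))
    where
    regroup : ∀ q d K p e → q * d * (K * (p * e)) ≡ q * K * p * (e * d)
    regroup = solve-∀

corollary2 : (Q : ℕ) → Q ∈ (1 ∷ 2 ∷ 6 ∷ 42 ∷ 1806 ∷ []) → (n : ℕ) → 1 ≤ n →
    (¬ InN Q n) ⇔
      Σ ℕ (λ d → Σ (NonZero d) (λ nz → d ∣ Q ×
        Σ ℕ (λ p → Σ ℕ (λ K → Prime p × p ∤ Q × d ∣ (p ∸ 1) × 1 ≤ K ×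
          n ≡ K * _/_ (p * (p ∸ 1)) d {{nz}}))))
corollary2 Q Q∈ n 0<n = mk⇔ ¬InN⇒InW InW⇒¬InN
  where
  admissible = listed-admissible Q∈
  ¬InN⇒InW : ¬ InN Q n → InW Q n
  ¬InN⇒InW ¬inN with badPrime? Q n 0<n
  ... | yes (_ , bad) = badPrime⇒InW 0<n bad
  ... | no  noBad     =
    contradiction (noBadPrime⇒InN admissible 0<n λ p bad → noBad (p , bad)) ¬inN
  InW⇒¬InN : InW Q n → ¬ InN Q n
  InW⇒¬InN inW = badPrime⇒¬InN (Admissible.positive admissible) 0<n (proj₂ (InW⇒badPrime inW))
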